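{- Let $G$ be a graph with $n$ vertices and maximum degree $\Delta(G)=n-1$. Then $G$ has a unique distance-balanced closure, which is isomorphic to $K_n$.
   Context: All graphs are finite and simple. For vertices $u,v$ of a graph $G$, $d_G(u,v)$ denotes the length of a shortest $u$–$v$ path. For an edge $xy$ of $G$, $W^G_{xy}=\{u\in V(G): d_G(u,x)<d_G(u,y)\}$. A graph $G$ is distance-balanced if $|W^G_{xy}|=|W^G_{yx}|$ for every edge $xy$ of $G$. For a graph $H$, $b(H)$ is the smallest number of edges which can be added to $H$ (keeping the vertex set) so that the resulting graph is distance-balanced. A graph $G$ is a distance-balanced closure of $H$ if $G$ is distance-balanced, $H$ is a spanning subgraph of $G$, and $|E(G)|=|E(H)|+b(H)$. -}

module Defs where

open import Data.Nat using (ℕ; zero; suc; _+_; _<ᵇ_; _≤_; _∸_)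
open import Data.Bool using (Bool; true; false; _∧_; _∨_; not; if_then_else_)
open import Data.Fin using (Fin; _≟_; _<?_)
open import Data.Product using (Σ; ∃; _×_)
open import Data.List using (List; length; filter)
open import Data.List using (allFin; map)
open import Data.Nat.ListAction using (sum)
open import Data.Bool.ListAction using () renaming (any to anyL)
open import Relation.Nullary.Decidable using (⌊_⌋; does)
open import Relation.Binary.PropositionalEquality using (_≡_)
open import Function.Bundles using (_↔_; Inverse)

record Graph (n : ℕ) : Set where
  field
    adj    : Fin n → Fin n → Bool
    sym    : ∀ u v → adj u v ≡ adj v u
    irrefl : ∀ u → adj u u ≡ false
open Graph public

count : {n : ℕ} → (Fin n → Bool) → ℕ
count {n} p = length (filter (λ i → p i Data.Bool.≟ true) (allFin n))

reachIn : {n : ℕ} → Graph n → ℕ → Fin n → Fin n → Bool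
reachIn G zero    u v = ⌊ u ≟ v ⌋
reachIn {n} G (suc k) u v =
  reachIn G k u v ∨ anyL (λ w → reachIn G k u w ∧ adj G w v) (allFin n)

-- d_G(u,v): the least k ≤ n with a walk of length ≤ k from u to v
-- (i.e. the length of a shortest path); if there is none, the value is n,
-- which plays the role of ∞ (every finite distance is ≤ n - 1 < n).
dist : {n : ℕ} → Graph n → Fin n → Fin n → ℕ
dist {n} G u v = go 0 n
  where
  go : ℕ → ℕ → ℕ
  go i zero    = i
  go i (suc f) = if reachIn G i u v then i else go (suc i) f

W : {n : ℕ} → Graph n → Fin n → Fin n → ℕ
W G x y = count (λ u → dist G u x <ᵇ dist G u y)

DistanceBalanced : {n : ℕ} → Graph n → Set
DistanceBalanced G = ∀ x y → adj G x y ≡ true → W G x y ≡ W G y x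

edges : {n : ℕ} → Graph n → ℕ
edges {n} G = sum (map (λ u → count (λ v → ⌊ u <? v ⌋ ∧ adj G u v)) (allFin n))

degree : {n : ℕ} → Graph n → Fin n → ℕ
degree G v = count (λ w → adj G v w)

MaxDegree : {n : ℕ} → Graph n → ℕ → Set
MaxDegree G m = (∃ λ v → degree G v ≡ m) × (∀ v → degree G v ≤ m)

_⊆G_ : {n : ℕ} → Graph n → Graph n → Set
H ⊆G G = ∀ u v → adj H u v ≡ true → adj G u v ≡ true

-- b(H) ≡ k : k is the smallest number of edges whose addition to H makes
-- it distance-balanced
IsB : {n : ℕ} → Graph n → ℕ → Set
IsB {n} H k =
  (Σ (Graph n) λ G → DistanceBalanced G × H ⊆G G × edges G ≡ edges H + k)
  × (∀ (G : Graph n) → DistanceBalanced G → H ⊆G G → edges H + k ≤ edges G)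

IsDBClosure : {n : ℕ} → Graph n → Graph n → Set
IsDBClosure H G =
  DistanceBalanced G × H ⊆G G × (∃ λ k → IsB H k × edges G ≡ edges H + k)

_≈G_ : {n : ℕ} → Graph n → Graph n → Set
G ≈G G' = ∀ u v → adj G u v ≡ adj G' u v

Complete : (n : ℕ) → Graph n
Complete n = record
  { adj = λ u v → not ⌊ u ≟ v ⌋
  ; sym = λ u v → symK u v
  ; irrefl = λ u → irrK u
  }
  where
  open import Relation.Binary.PropositionalEquality using (refl; cong)
  open import Relation.Nullary using (yes; no)
  symK : ∀ (u v : Fin n) → not ⌊ u ≟ v ⌋ ≡ not ⌊ v ≟ u ⌋
  symK u v with u ≟ v | v ≟ u
  ... | yes _ | yes _ = refl
  ... | no _  | no _  = refl
  ... | yes p | no q  = Data.Empty.⊥-elim (q (Relation.Binary.PropositionalEquality.sym p))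
    where import Data.Empty
  ... | no p  | yes q = Data.Empty.⊥-elim (p (Relation.Binary.PropositionalEquality.sym q))
    where import Data.Empty
  irrK : ∀ (u : Fin n) → not ⌊ u ≟ u ⌋ ≡ false
  irrK u with u ≟ u
  ... | yes _ = refl
  ... | no ¬p = Data.Empty.⊥-elim (¬p refl)
    where import Data.Empty

Isomorphic : {n : ℕ} → Graph n → Graph n → Set
Isomorphic {n} G G' =
  Σ (Fin n ↔ Fin n) λ f → ∀ u v → adj G u v ≡ adj G' (Inverse.to f u) (Inverse.to f v)

module Submission where

-- A vertex v of degree n − 1 in H is adjacent to every other vertex in each supergraph G of H.
-- Such a G, if distance-balanced, is complete: were x ≠ y non-adjacent, then on the edge xv only x
-- is closer to x than to v (everybody else is within distance 1 of v), while both v and y (at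
-- distance 1 from v and 2 from x) are closer to v, so |W_xv| ≤ 1 < 2 ≤ |W_vx|. Hence K_n is the
-- only distance-balanced supergraph of H, and being distance-balanced itself it is the unique
-- distance-balanced closure.

open import Defs hiding (sym)
open import Data.Nat using (ℕ; zero; suc; _+_; _∸_; _≤_; _<_; _<ᵇ_; z≤n; s≤s)
open import Data.Nat.Properties
  using (+-suc; +-comm; ≤-trans; ≤-reflexive; ≤-antisym; m≤n+m; +-mono-≤; +-monoʳ-≤; +-cancelˡ-≤;
         n≮0; ≤⇒≯; m+[n∸m]≡n; <ᵇ⇒<; module ≤-Reasoning)
open import Data.Bool using (Bool; true; false; _∧_; _∨_; not; if_then_else_; T) renaming (_≟_ to _≟ᵇ_)
open import Data.Bool.Properties using (∨-zeroʳ; ¬-not)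
open import Data.Bool.ListAction using (any)
open import Data.Fin using (Fin; zero; suc; _≟_; _<?_)
open import Data.Fin.Properties using (0≢1+n; suc-injective)
open import Data.List using (List; []; _∷_; length; filter; tabulate; allFin; map)
open import Data.Nat.ListAction using (sum)
open import Data.Product using (Σ; _×_; _,_; proj₁; proj₂)
open import Function using (_∘_; id)
open import Function.Construct.Identity using (↔-id)
open import Relation.Nullary using (yes; no; contradiction)
open import Relation.Nullary.Decidable using (⌊_⌋)
open import Relation.Binary.PropositionalEquality

count-tabulate : ∀ {m n} (f : Fin n → Fin m) (p : Fin m → Bool) →
  length (filter (λ i → p i ≟ᵇ true) (tabulate f)) ≡ count (p ∘ f)
count-tabulate {n = zero} f p = refl
count-tabulate {n = suc n} f p with p (f zero)
... | true = cong suc (trans (count-tabulate (f ∘ suc) p) (sym (count-tabulate suc (p ∘ f))))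
... | false = trans (count-tabulate (f ∘ suc) p) (sym (count-tabulate suc (p ∘ f)))

count-suc : ∀ {n} (p : Fin (suc n) → Bool) →
  count p ≡ (if p zero then 1 else 0) + count (p ∘ suc)
count-suc p with p zero
... | true = cong suc (count-tabulate suc p)
... | false = count-tabulate suc p

count-none : ∀ {n} (p : Fin n → Bool) → (∀ i → p i ≡ false) → count p ≡ 0
count-none {zero} p none = refl
count-none {suc n} p none rewrite count-suc p | none zero = count-none (p ∘ suc) (none ∘ suc)

count-≤1 : ∀ {n} (p : Fin n → Bool) a → (∀ i → p i ≡ true → i ≡ a) → count p ≤ 1
count-≤1 {suc n} p zero only
  rewrite count-suc p | count-none (p ∘ suc) (λ i → ¬-not (0≢1+n ∘ sym ∘ only (suc i)))
  with p zero
... | true = s≤s z≤n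
... | false = z≤n
count-≤1 {suc n} p (suc a) only rewrite count-suc p with p zero in p0
... | true = contradiction (only zero p0) 0≢1+n
... | false = count-≤1 (p ∘ suc) a (λ i pi → suc-injective (only (suc i) pi))

count-≥1 : ∀ {n} (p : Fin n → Bool) a → p a ≡ true → 1 ≤ count p
count-≥1 {suc n} p zero pa rewrite count-suc p | pa = s≤s z≤n
count-≥1 {suc n} p (suc a) pa rewrite count-suc p = ≤-trans (count-≥1 (p ∘ suc) a pa) (m≤n+m _ _)

count-≥2 : ∀ {n} (p : Fin n → Bool) a b → a ≢ b → p a ≡ true → p b ≡ true → 2 ≤ count p
count-≥2 {suc n} p zero zero a≢b _ _ = contradiction refl a≢b
count-≥2 {suc n} p zero (suc b) _ pa pb rewrite count-suc p | pa = s≤s (count-≥1 (p ∘ suc) b pb)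
count-≥2 {suc n} p (suc a) zero _ pa pb rewrite count-suc p | pb = s≤s (count-≥1 (p ∘ suc) a pa)
count-≥2 {suc n} p (suc a) (suc b) a≢b pa pb rewrite count-suc p =
  ≤-trans (count-≥2 (p ∘ suc) a b (a≢b ∘ cong suc) pa pb) (m≤n+m _ _)

count-mono : ∀ {n} (p q : Fin n → Bool) → (∀ i → p i ≡ true → q i ≡ true) → count p ≤ count q
count-mono {zero} p q p⇒q = z≤n
count-mono {suc n} p q p⇒q rewrite count-suc p | count-suc q with p zero in p0 | q zero in q0
... | true | true = s≤s (count-mono (p ∘ suc) (q ∘ suc) (p⇒q ∘ suc))
... | true | false = contradiction (trans (sym (p⇒q zero p0)) q0) λ ()
... | false | true = ≤-trans (count-mono (p ∘ suc) (q ∘ suc) (p⇒q ∘ suc)) (m≤n+m _ 1)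
... | false | false = count-mono (p ∘ suc) (q ∘ suc) (p⇒q ∘ suc)

count-complement : ∀ {n} (p : Fin n → Bool) → count p + count (not ∘ p) ≡ n
count-complement {zero} p = refl
count-complement {suc n} p rewrite count-suc p | count-suc (not ∘ p) with p zero
... | true = cong suc (count-complement (p ∘ suc))
... | false = trans (+-suc _ _) (cong suc (count-complement (p ∘ suc)))

any-tabulate⁺ : ∀ {m n} (f : Fin n → Fin m) (p : Fin m → Bool) w →
  p (f w) ≡ true → any p (tabulate f) ≡ true
any-tabulate⁺ f p zero pw rewrite pw = refl
any-tabulate⁺ f p (suc w) pw rewrite any-tabulate⁺ (f ∘ suc) p w pw = ∨-zeroʳ (p (f zero))

any-tabulate⁻ : ∀ {m n} (f : Fin n → Fin m) (p : Fin m → Bool) →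
  (∀ w → p (f w) ≡ false) → any p (tabulate f) ≡ false
any-tabulate⁻ {n = zero} f p none = refl
any-tabulate⁻ {n = suc n} f p none rewrite none zero = any-tabulate⁻ (f ∘ suc) p (none ∘ suc)

adj⇒≢ : ∀ {n} (G : Graph n) {u v} → adj G u v ≡ true → u ≢ v
adj⇒≢ G {u} uv refl = contradiction (trans (sym uv) (irrefl G u)) λ ()

module _ {n : ℕ} (G : Graph n) where

  reachIn-0-refl : ∀ u → reachIn G 0 u u ≡ true
  reachIn-0-refl u with u ≟ u
  ... | yes _ = refl
  ... | no u≢u = contradiction refl u≢u

  reachIn-0-≢ : ∀ {u v} → u ≢ v → reachIn G 0 u v ≡ false
  reachIn-0-≢ {u} {v} u≢v with u ≟ v
  ... | yes u≡v = contradiction u≡v u≢v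
  ... | no _ = refl

  reachIn-step : ∀ k {u w v} → reachIn G k u w ≡ true → adj G w v ≡ true →
    reachIn G (suc k) u v ≡ true
  reachIn-step k {u} {w} {v} uw wv =
    trans (cong (reachIn G k u v ∨_)
                (any-tabulate⁺ id (λ x → reachIn G k u x ∧ adj G x v) w (cong₂ _∧_ uw wv)))
          (∨-zeroʳ _)

  reachIn-1-nonadj : ∀ {u v} → u ≢ v → adj G u v ≡ false → reachIn G 1 u v ≡ false
  reachIn-1-nonadj {u} {v} u≢v uv rewrite reachIn-0-≢ u≢v =
    any-tabulate⁻ id (λ x → reachIn G 0 u x ∧ adj G x v) via
    where
    via : ∀ w → (reachIn G 0 u w ∧ adj G w v) ≡ false
    via w with u ≟ w
    ... | yes refl = uv
    ... | no _ = refl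

if-true : ∀ {A : Set} {b} {x y : A} → b ≡ true → (if b then x else y) ≡ x
if-true refl = refl

if-false : ∀ {A : Set} {b} {x y : A} → b ≡ false → (if b then x else y) ≡ y
if-false refl = refl

dist-refl : ∀ {n} (G : Graph n) u → dist G u u ≡ 0
dist-refl {suc n} G u = if-true (reachIn-0-refl G u)

dist-adj : ∀ {n} (G : Graph n) {u v} → adj G u v ≡ true → dist G u v ≡ 1
dist-adj {suc zero} G {zero} {zero} uv = contradiction refl (adj⇒≢ G uv)
dist-adj {suc (suc n)} G {u} uv =
  trans (if-false (reachIn-0-≢ G (adj⇒≢ G uv))) (if-true (reachIn-step G 0 (reachIn-0-refl G u) uv))

dist-common-neighbour : ∀ {n} (G : Graph n) {u v} w → u ≢ v → adj G u v ≡ false →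
  adj G u w ≡ true → adj G w v ≡ true → dist G u v ≡ 2
dist-common-neighbour {suc zero} G {zero} {zero} w u≢v = contradiction refl u≢v
-- With n = 2 the search in `dist` gives up after lengths 0 and 1 and returns 2 = n.
dist-common-neighbour {suc (suc zero)} G w u≢v uv _ _ =
  trans (if-false (reachIn-0-≢ G u≢v)) (if-false (reachIn-1-nonadj G u≢v uv))
dist-common-neighbour {suc (suc (suc n))} G {u} w u≢v uv uw wv =
  trans (if-false (reachIn-0-≢ G u≢v)) (trans (if-false (reachIn-1-nonadj G u≢v uv))
    (if-true (reachIn-step G 1 {u} (reachIn-step G 0 (reachIn-0-refl G u) uw) wv)))

<ᵇ-true⇒< : ∀ {m k} → (m <ᵇ k) ≡ true → m < k
<ᵇ-true⇒< {m} {k} m<ᵇk = <ᵇ⇒< m k (subst T (sym m<ᵇk) _)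

Universal : ∀ {n} → Graph n → Fin n → Set
Universal G v = ∀ w → w ≢ v → adj G v w ≡ true

degree-n∸1⇒Universal : ∀ {n} (H : Graph n) v → degree H v ≡ n ∸ 1 → Universal H v
degree-n∸1⇒Universal {suc m} H v deg w w≢v with adj H v w in vw
... | true = refl
... | false = contradiction (+-cancelˡ-≤ m 2 1 m+2≤m+1) λ { (s≤s ()) }
  where
  open ≤-Reasoning
  2≤non-neighbours : 2 ≤ count (not ∘ adj H v)
  2≤non-neighbours = count-≥2 (not ∘ adj H v) v w (w≢v ∘ sym) (cong not (irrefl H v)) (cong not vw)
  m+2≤m+1 : m + 2 ≤ m + 1
  m+2≤m+1 = begin
    m + 2                                    ≤⟨ +-monoʳ-≤ m 2≤non-neighbours ⟩
    m + count (not ∘ adj H v)                ≡⟨ cong (_+ count (not ∘ adj H v)) (sym deg) ⟩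
    count (adj H v) + count (not ∘ adj H v)  ≡⟨ count-complement (adj H v) ⟩
    suc m                                    ≡⟨ +-comm 1 m ⟩
    m + 1                                    ∎

module _ {n : ℕ} {G : Graph n} {v : Fin n} (univ : Universal G v) where

  Universal-adj : ∀ {w} → w ≢ v → adj G w v ≡ true
  Universal-adj {w} w≢v = trans (Graph.sym G w v) (univ w w≢v)

  Universal-nonadj⇒≢ : ∀ {x y} → x ≢ y → adj G x y ≡ false → x ≢ v
  Universal-nonadj⇒≢ x≢y xy refl = contradiction (trans (sym (univ _ (x≢y ∘ sym))) xy) λ ()

  Universal⇒dist-pos : ∀ {u x} → u ≢ x → 1 ≤ dist G u x
  Universal⇒dist-pos {u} {x} u≢x with adj G u x in ux
  ... | true = ≤-reflexive (sym (dist-adj G ux))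
  ... | false = subst (1 ≤_) (sym (dist-common-neighbour G v u≢x ux (Universal-adj u≢v) (univ x x≢v)))
                      (s≤s z≤n)
    where
    u≢v = Universal-nonadj⇒≢ u≢x ux
    x≢v = Universal-nonadj⇒≢ (u≢x ∘ sym) (trans (Graph.sym G x u) ux)

  W-universal-≤1 : ∀ x → W G x v ≤ 1
  W-universal-≤1 x = count-≤1 _ x closer-only-x
    where
    closer-only-x : ∀ u → (dist G u x <ᵇ dist G u v) ≡ true → u ≡ x
    closer-only-x u closer with u ≟ x | u ≟ v
    ... | yes u≡x | _ = u≡x
    ... | no _ | yes refl = contradiction (subst (dist G u x <_) (dist-refl G u) (<ᵇ-true⇒< closer)) n≮0
    ... | no u≢x | no u≢v =
      contradiction (subst (dist G u x <_) (dist-adj G (Universal-adj u≢v)) (<ᵇ-true⇒< closer))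
                    (≤⇒≯ (Universal⇒dist-pos u≢x))

  W-universal-≥2 : ∀ {x y} → x ≢ y → adj G x y ≡ false → 2 ≤ W G v x
  W-universal-≥2 {x} {y} x≢y xy = count-≥2 _ v y (y≢v ∘ sym) v-closer y-closer
    where
    yx = trans (Graph.sym G y x) xy
    x≢v = Universal-nonadj⇒≢ x≢y xy
    y≢v = Universal-nonadj⇒≢ (x≢y ∘ sym) yx
    v-closer : (dist G v v <ᵇ dist G v x) ≡ true
    v-closer = cong₂ _<ᵇ_ (dist-refl G v) (dist-adj G (univ x x≢v))
    y-closer : (dist G y v <ᵇ dist G y x) ≡ true
    y-closer = cong₂ _<ᵇ_ (dist-adj G (Universal-adj y≢v))
                          (dist-common-neighbour G v (x≢y ∘ sym) yx (Universal-adj y≢v) (univ x x≢v))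

  balanced⇒adj : DistanceBalanced G → ∀ {x y} → x ≢ y → adj G x y ≡ true
  balanced⇒adj balanced {x} {y} x≢y with adj G x y in xy
  ... | true = refl
  ... | false = contradiction 2≤1 λ { (s≤s ()) }
    where
    open ≤-Reasoning
    2≤1 : 2 ≤ 1
    2≤1 = begin
      2        ≤⟨ W-universal-≥2 x≢y xy ⟩
      W G v x  ≡⟨ balanced v x (univ x (Universal-nonadj⇒≢ x≢y xy)) ⟩
      W G x v  ≤⟨ W-universal-≤1 x ⟩
      1        ∎

adj⇒W-≥1 : ∀ {n} (G : Graph n) {x y} → adj G x y ≡ true → 1 ≤ W G x y
adj⇒W-≥1 G {x} xy = count-≥1 _ x (cong₂ _<ᵇ_ (dist-refl G x) (dist-adj G xy))

Complete-adj : ∀ {n} {u v : Fin n} → u ≢ v → adj (Complete n) u v ≡ true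
Complete-adj {u = u} {v} u≢v with u ≟ v
... | yes u≡v = contradiction u≡v u≢v
... | no _ = refl

Complete-Universal : ∀ {n} (v : Fin n) → Universal (Complete n) v
Complete-Universal v w w≢v = Complete-adj (w≢v ∘ sym)

Complete-balanced : ∀ n → DistanceBalanced (Complete n)
Complete-balanced n x y xy = trans (W≡1 xy) (sym (W≡1 (trans (Graph.sym (Complete n) y x) xy)))
  where
  W≡1 : ∀ {x y} → adj (Complete n) x y ≡ true → W (Complete n) x y ≡ 1
  W≡1 {x} {y} xy = ≤-antisym (W-universal-≤1 (Complete-Universal y) x) (adj⇒W-≥1 (Complete n) xy)

⊆Complete : ∀ {n} (H : Graph n) → H ⊆G Complete n
⊆Complete H u v uv = Complete-adj (adj⇒≢ H uv)

≈Complete : ∀ {n} (G : Graph n) → (∀ {u v} → u ≢ v → adj G u v ≡ true) → G ≈G Complete n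
≈Complete G complete u v with u ≟ v
... | yes refl = irrefl G u
... | no u≢v = complete u≢v

sum-map-mono : ∀ {A : Set} (xs : List A) {f g : A → ℕ} → (∀ x → f x ≤ g x) →
  sum (map f xs) ≤ sum (map g xs)
sum-map-mono [] f≤g = z≤n
sum-map-mono (x ∷ xs) f≤g = +-mono-≤ (f≤g x) (sum-map-mono xs f≤g)

edges-mono : ∀ {n} (H G : Graph n) → H ⊆G G → edges H ≤ edges G
edges-mono {n} H G H⊆G = sum-map-mono (allFin n) λ u → count-mono _ _ (edge-mono u)
  where
  edge-mono : ∀ u v → (⌊ u <? v ⌋ ∧ adj H u v) ≡ true → (⌊ u <? v ⌋ ∧ adj G u v) ≡ true
  edge-mono u v with ⌊ u <? v ⌋
  ... | true = H⊆G u v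
  ... | false = λ ()

≈G⇒⊇G : ∀ {n} (G G′ : Graph n) → G ≈G G′ → G′ ⊆G G
≈G⇒⊇G G G′ G≈G′ u v uv = trans (G≈G′ u v) uv

unique-closure : ∀ {n} (H G₀ : Graph n) → DistanceBalanced G₀ → H ⊆G G₀ →
  (∀ G → DistanceBalanced G → H ⊆G G → G ≈G G₀) →
  IsDBClosure H G₀ × (∀ G → IsDBClosure H G → G ≈G G₀)
unique-closure H G₀ balanced₀ H⊆G₀ only =
  (balanced₀ , H⊆G₀ , k , isB , edges-G₀) , λ G (balanced , H⊆G , _) → only G balanced H⊆G
  where
  k = edges G₀ ∸ edges H
  edges-G₀ : edges G₀ ≡ edges H + k
  edges-G₀ = sym (m+[n∸m]≡n (edges-mono H G₀ H⊆G₀))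
  isB : IsB H k
  isB = (G₀ , balanced₀ , H⊆G₀ , edges-G₀) ,
        λ G balanced H⊆G →
          subst (_≤ edges G) edges-G₀ (edges-mono G₀ G (≈G⇒⊇G G G₀ (only G balanced H⊆G)))

corollary2p3 : (n : ℕ) (H : Graph n) → MaxDegree H (n ∸ 1) →
    Σ (Graph n) λ G → IsDBClosure H G × (∀ G' → IsDBClosure H G' → G' ≈G G)
      × Isomorphic G (Complete n)
corollary2p3 n H ((v , deg) , _) =
  Complete n , proj₁ closure , proj₂ closure , (↔-id (Fin n) , λ _ _ → refl)
  where
  univ : Universal H v
  univ = degree-n∸1⇒Universal H v deg
  closure = unique-closure H (Complete n) (Complete-balanced n) (⊆Complete H) λ G balanced H⊆G →
    ≈Complete G (balanced⇒adj (λ w w≢v → H⊆G v w (univ w w≢v)) balanced)
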